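{- Let $k\ge2$, $n\in\mathbb{N}$ and $w\in S_n$. If there exists $i_0\in\mathbb{N}$ such that $w_i>w_{i+1}$ for all indices $i$ with $i_0\le i\le n-1$, then $\mathcal{C}_{k,n,w}$ has at least $\sum_{j=i_0}^{n-1}(k-1)k^{j-1}$ descents and at least $\frac{k^n(k-1)}{4}\left(\frac{k^{n-i_0+1}-1}{k-1}-(n-i_0+1)\right)$ inversions.
   Context: The infinite rooted directed $k$-ary tree has a root on layer $1$; every vertex has $k$ children, ordered left to right, on the next layer. A vertex with at least $k$ chips may fire by choosing $k$ of its labeled chips and sending the $j$th smallest to its $j$th leftmost child. Chips $0,\dots,k^n-1$ start at the root and are written in $n$-digit $k$-ary expansion. For $w\in S_n$, the strategy $F_w$ fires, for each $i\in[n]$, each vertex $v$ on layer $i$ so that all chips on $v$ whose $w_i$th most significant digit equals $j$ go to the $(j+1)$th leftmost child of $v$. $\mathcal{C}_{k,n,w}=(\pi_1,\dots,\pi_{k^n})$ is the resulting stable configuration, read as the sequence of chips on layer $n+1$ from left to right. A descent is an $i$ with $\pi_i>\pi_{i+1}$; an inversion is a pair of positions $a<b$ with $\pi_a>\pi_b$. -}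

module Defs where

open import Data.Nat using (ℕ; zero; suc; _+_; _*_; _∸_; _^_; _<_; _<?_)
open import Data.Nat.DivMod using (_/_; _%_)
open import Data.Nat.Properties using (_≟_)
open import Data.Fin using (Fin; toℕ)
open import Data.Fin.Permutation using (Permutation′; _⟨$⟩ʳ_)
open import Data.List using (List; []; _∷_; map; filter; concatMap; concat; foldl; upTo; length; sum)
open import Data.List.Base using (allFin)
open import Relation.Nullary using (does)
open import Data.Bool using (if_then_else_)

-- Division / remainder by a possibly-zero divisor (only ever used with
-- divisors k ^ e and k where k ≥ 2; the zero case is an irrelevant convention).
divN : ℕ → ℕ → ℕ
divN m zero = 0
divN m (suc d) = m / suc d

modN : ℕ → ℕ → ℕ
modN m zero = m
modN m (suc d) = m % suc d

-- The (d+1)-th most significant digit (d 0-based) of c in its n-digit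
-- k-ary expansion.
digit : (k n d c : ℕ) → ℕ
digit k n d c = modN (divN c (k ^ (n ∸ suc d))) k

-- Firing a vertex carrying the chips cs according to F_w at a layer whose
-- relevant digit is the (d+1)-th most significant: the j-th child (j = 0..k-1,
-- left to right) receives the chips whose digit equals j.
fireVertex : (k n d : ℕ) → List ℕ → List (List ℕ)
fireVertex k n d cs = map (λ j → filter (λ c → digit k n d c ≟ j) cs) (upTo k)

layer1 : (k n : ℕ) → List (List ℕ)
layer1 k n = upTo (k ^ n) ∷ []

-- Apply the firing of layer i (i = 1..n) of F_w: every vertex on layer i
-- fires according to the w_i-th most significant digit; obtain the chip lists
-- of the vertices on layer n+1, left to right.
finalLayer : (k n : ℕ) → Permutation′ n → List (List ℕ)
finalLayer k n w =
  foldl (λ L i → concatMap (fireVertex k n (toℕ (w ⟨$⟩ʳ i))) L)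
        (layer1 k n) (allFin n)

config : (k n : ℕ) → Permutation′ n → List ℕ
config k n w = concat (finalLayer k n w)

descents : List ℕ → ℕ
descents [] = 0
descents (x ∷ r) = go x r
  where
  go : ℕ → List ℕ → ℕ
  go p [] = 0
  go p (y ∷ r') = (if does (y <? p) then 1 else 0) + go y r'

inversions : List ℕ → ℕ
inversions [] = 0
inversions (x ∷ r) = length (filter (λ y → y <? x) r) + inversions r

range : ℕ → ℕ → List ℕ
range a b = map (a +_) (upTo (b ∸ a))

module Submission where

-- Write the chips in base k.  Firing the root by the digit in position w₁ sends to the j-th child
-- exactly the chips with digit j there; deleting that digit renumbers them as 0, …, k^(n-1) - 1, and
-- the remaining firings treat them as F_{w′} does, where w′ is w with w₁ removed.  Hence 𝒞_{k,n,w}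
-- is the concatenation over j < k of the images of 𝒞_{k,n-1,w′} under the strictly increasing maps
-- "insert the digit j", so it has at least k times as many descents and inversions.  When w is
-- decreasing throughout, the inserted digit is always the least significant one, 𝒞_{k,n,w} is the
-- concatenation of the blocks X·k + j (j < k) for X = 𝒞_{k,n-1,w′}, and its descents and inversions
-- satisfy exact recurrences; this is the case i₀ = 1, and the first observation lowers i₀ by one.

open import Defs
open import Data.Bool using (true; false; if_then_else_)
open import Data.Fin as Fin using (Fin; toℕ; zero; suc; punchIn)
open import Data.Fin.Properties using (toℕ<n; toℕ-fromℕ<; punchIn-mono-≤)
open import Data.Fin.Permutation using (Permutation′; _⟨$⟩ʳ_; remove; punchIn-permute)
open import Data.List
  using (List; []; _∷_; [_]; _++_; map; concat; concatMap; filter; foldl; length; upTo; applyUpTo; tabulate; allFin)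
open import Data.List.Properties
  using ( ++-identityʳ; map-id; map-++; map-∘; map-cong; map-cong-local; map-upTo; map-tabulate; map-concatMap
        ; concatMap-map; concatMap-cong; concatMap-pure; concatMap-++; concat-concat; concat-map; foldl-map
        ; filter-++; filter-all; filter-none; filter-accept; filter-reject; filter-≐
        ; upTo-∷ʳ; length-++; length-map; length-upTo )
open import Data.List.Relation.Unary.All as All using (All; []; _∷_)
open import Data.List.Relation.Unary.All.Properties using (applyUpTo⁺₁; applyUpTo⁺₂; map⁺)
open import Data.Nat
open import Data.Nat.DivMod
open import Data.Nat.Divisibility using (n∣m*n)
open import Data.Nat.ListAction using (sum)
open import Data.Nat.ListAction.Properties using (sum-++)
open import Data.Nat.Properties
open import Data.Nat.Tactic.RingSolver using (solve-∀)
open import Data.Product using (_×_; _,_; proj₁; proj₂)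
open import Data.Sum using (_⊎_; inj₁; inj₂)
open import Function using (_∘_; id)
open import Relation.Binary.Core using (_Preserves_⟶_)
open import Relation.Binary.PropositionalEquality
  using (_≡_; refl; sym; trans; cong; cong₂; subst; subst₂; module ≡-Reasoning)
open import Relation.Nullary using (Dec; yes; no; does)
open import Relation.Nullary.Decidable using (dec-true; dec-false)
open import Relation.Nullary.Negation using (contradiction)
open import Relation.Unary using (Decidable)

open import Algebra.Properties.CommutativeSemigroup *-commutativeSemigroup using (x∙yz≈y∙xz)

[m*n+o]/n≡m : ∀ m {n o} .{{_ : NonZero n}} → o < n → (m * n + o) / n ≡ m
[m*n+o]/n≡m m {n} {o} o<n = begin
  (m * n + o) / n     ≡⟨ +-distrib-/-∣ˡ o (n∣m*n m) ⟩
  m * n / n + o / n   ≡⟨ cong₂ _+_ (m*n/n≡m m n) (m<n⇒m/n≡0 o<n) ⟩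
  m + 0               ≡⟨ +-identityʳ m ⟩
  m                   ∎
  where open ≡-Reasoning

[m*n+o]%n≡o : ∀ m {n o} .{{_ : NonZero n}} → o < n → (m * n + o) % n ≡ o
[m*n+o]%n≡o m {n} {o} o<n = trans (%-remove-+ˡ o (n∣m*n m)) (m<n⇒m%n≡m o<n)

m<n⇒m*o+p<n*o+q : ∀ {m n o p q} → m < n → p < o → m * o + p < n * o + q
m<n⇒m*o+p<n*o+q {m} {n} {o} {p} {q} m<n p<o = begin-strict
  m * o + p  <⟨ +-monoʳ-< (m * o) p<o ⟩
  m * o + o  ≡⟨ +-comm (m * o) o ⟩
  suc m * o  ≤⟨ *-monoˡ-≤ o m<n ⟩
  n * o      ≤⟨ m≤m+n (n * o) q ⟩
  n * o + q  ∎
  where open ≤-Reasoning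

m*o≤n*p⇒m*q*o≤n*q*p : ∀ m n q {o p} → m * o ≤ n * p → m * q * o ≤ n * q * p
m*o≤n*p⇒m*q*o≤n*q*p m n q {o} {p} mo≤np = begin
  m * q * o    ≡⟨ *-assoc m q o ⟩
  m * (q * o)  ≡⟨ x∙yz≈y∙xz m q o ⟩
  q * (m * o)  ≤⟨ *-monoʳ-≤ q mo≤np ⟩
  q * (n * p)  ≡⟨ x∙yz≈y∙xz q n p ⟩
  n * (q * p)  ≡⟨ *-assoc n q p ⟨
  n * q * p    ∎
  where open ≤-Reasoning

triangular : ℕ → ℕ
triangular zero    = 0
triangular (suc m) = m + triangular m

2*triangular+n≡n*n : ∀ n → 2 * triangular n + n ≡ n * n
2*triangular+n≡n*n zero    = refl
2*triangular+n≡n*n (suc n) = begin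
  2 * (n + triangular n) + suc n   ≡⟨ reassoc n (triangular n) ⟩
  (2 * triangular n + n) + (n + suc n) ≡⟨ cong (_+ (n + suc n)) (2*triangular+n≡n*n n) ⟩
  n * n + (n + suc n)              ≡⟨ square-suc n ⟩
  suc n * suc n                    ∎
  where
  open ≡-Reasoning
  reassoc : ∀ n t → 2 * (n + t) + suc n ≡ (2 * t + n) + (n + suc n)
  reassoc = solve-∀
  square-suc : ∀ n → n * n + (n + suc n) ≡ suc n * suc n
  square-suc = solve-∀

does-⇔ : ∀ {A B : Set} (a? : Dec A) (b? : Dec B) → (A → B) → (B → A) → does a? ≡ does b?
does-⇔ (yes a) b? f g = sym (dec-true b? (f a))
does-⇔ (no ¬a) b? f g = sym (dec-false b? (¬a ∘ g))

upTo-+ : ∀ m n → upTo (m + n) ≡ upTo m ++ map (m +_) (upTo n)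
upTo-+ zero    n = sym (map-id (upTo n))
upTo-+ (suc m) n = begin
  0 ∷ applyUpTo suc (m + n)                             ≡⟨ cong (0 ∷_) (sym (map-upTo suc (m + n))) ⟩
  0 ∷ map suc (upTo (m + n))                            ≡⟨ cong (λ xs → 0 ∷ map suc xs) (upTo-+ m n) ⟩
  0 ∷ map suc (upTo m ++ map (m +_) (upTo n))           ≡⟨ cong (0 ∷_) (map-++ suc (upTo m) _) ⟩
  0 ∷ map suc (upTo m) ++ map suc (map (m +_) (upTo n)) ≡⟨ cong₂ (λ xs ys → 0 ∷ xs ++ ys) (map-upTo suc m) (sym (map-∘ (upTo n))) ⟩
  0 ∷ applyUpTo suc m ++ map (suc m +_) (upTo n)        ∎
  where open ≡-Reasoning

upTo-* : ∀ m n → upTo (m * n) ≡ concatMap (λ q → map (λ r → q * n + r) (upTo n)) (upTo m)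
upTo-* zero    n = refl
upTo-* (suc m) n = begin
  upTo (n + m * n)                                            ≡⟨ upTo-+ n (m * n) ⟩
  upTo n ++ map (n +_) (upTo (m * n))                         ≡⟨ cong₂ _++_ (sym (map-id (upTo n))) (cong (map (n +_)) (upTo-* m n)) ⟩
  map id (upTo n) ++ map (n +_) (concatMap (block n) (upTo m)) ≡⟨ cong (map id (upTo n) ++_) (map-concatMap (n +_) (block n) (upTo m)) ⟩
  map id (upTo n) ++ concatMap (map (n +_) ∘ block n) (upTo m) ≡⟨ cong (map id (upTo n) ++_) (concatMap-cong shift (upTo m)) ⟩
  map id (upTo n) ++ concatMap (block n ∘ suc) (upTo m)        ≡⟨ cong (map id (upTo n) ++_) (sym (concatMap-map (block n) suc (upTo m))) ⟩
  map id (upTo n) ++ concatMap (block n) (map suc (upTo m))    ≡⟨ cong (λ qs → map id (upTo n) ++ concatMap (block n) qs) (map-upTo suc m) ⟩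
  concatMap (block n) (upTo (suc m))                           ∎
  where
  open ≡-Reasoning
  block : ℕ → ℕ → List ℕ
  block n q = map (λ r → q * n + r) (upTo n)
  shift : ∀ q → map (n +_) (block n q) ≡ block n (suc q)
  shift q = trans (sym (map-∘ (upTo n))) (map-cong (λ r → sym (+-assoc n (q * n) r)) (upTo n))

module _ (f g : ℕ → ℕ) (j : ℕ) where

  filter-concatMap-keyed : ∀ (G : ℕ → List ℕ) ds → All (λ d → All (λ x → f x ≡ g d) (G d)) ds →
                           filter (λ x → f x ≟ j) (concatMap G ds) ≡ concatMap G (filter (λ d → g d ≟ j) ds)
  filter-concatMap-keyed G []       []                = refl
  filter-concatMap-keyed G (d ∷ ds) (fG≡gd ∷ fGs≡gds) = begin
    filter P? (G d ++ concatMap G ds)             ≡⟨ filter-++ P? (G d) (concatMap G ds) ⟩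
    filter P? (G d) ++ filter P? (concatMap G ds) ≡⟨ cong (filter P? (G d) ++_) (filter-concatMap-keyed G ds fGs≡gds) ⟩
    filter P? (G d) ++ concatMap G (filter Q? ds) ≡⟨ first-block (Q? d) ⟩
    concatMap G (filter Q? (d ∷ ds))              ∎
    where
    open ≡-Reasoning
    P? = λ x → f x ≟ j
    Q? = λ d → g d ≟ j
    first-block : Dec (g d ≡ j) → filter P? (G d) ++ concatMap G (filter Q? ds) ≡ concatMap G (filter Q? (d ∷ ds))
    first-block (yes gd≡j) = trans (cong (_++ concatMap G (filter Q? ds)) (filter-all P? (All.map (λ e → trans e gd≡j) fG≡gd)))
                                   (cong (concatMap G) (sym (filter-accept Q? gd≡j)))
    first-block (no gd≢j)  = trans (cong (_++ concatMap G (filter Q? ds)) (filter-none P? (All.map (λ e → gd≢j ∘ trans (sym e)) fG≡gd)))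
                                   (cong (concatMap G) (sym (filter-reject Q? gd≢j)))

filter-≟-upTo : ∀ {m j} → j < m → filter (_≟ j) (upTo m) ≡ [ j ]
filter-≟-upTo {suc m} {j} j<1+m = begin
  filter (_≟ j) (upTo (suc m))                   ≡⟨ cong (filter (_≟ j)) (sym (upTo-∷ʳ m)) ⟩
  filter (_≟ j) (upTo m ++ [ m ])                ≡⟨ filter-++ (_≟ j) (upTo m) [ m ] ⟩
  filter (_≟ j) (upTo m) ++ filter (_≟ j) [ m ]  ≡⟨ split (m≤n⇒m<n∨m≡n (s≤s⁻¹ j<1+m)) ⟩
  [ j ]                                          ∎
  where
  open ≡-Reasoning
  split : j < m ⊎ j ≡ m → filter (_≟ j) (upTo m) ++ filter (_≟ j) [ m ] ≡ [ j ]
  split (inj₁ j<m)  = cong₂ _++_ (filter-≟-upTo j<m) (filter-reject (_≟ j) (>⇒≢ j<m))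
  split (inj₂ refl) = cong₂ _++_ (filter-none (_≟ j) (applyUpTo⁺₁ id j <⇒≢)) (filter-accept (_≟ j) refl)

filter-concatMap : ∀ {P : ℕ → Set} (P? : Decidable P) (G : ℕ → List ℕ) ds →
                   filter P? (concatMap G ds) ≡ concatMap (filter P? ∘ G) ds
filter-concatMap P? G []       = refl
filter-concatMap P? G (d ∷ ds) = trans (filter-++ P? (G d) _) (cong (filter P? (G d) ++_) (filter-concatMap P? G ds))

concatMap-singleton : ∀ (f : ℕ → ℕ) xs → concatMap (λ x → [ f x ]) xs ≡ map f xs
concatMap-singleton f xs = trans (sym (concatMap-map [_] f xs)) (concatMap-pure (map f xs))

filter-map : ∀ {P : ℕ → Set} (P? : Decidable P) (f : ℕ → ℕ) xs → filter P? (map f xs) ≡ map f (filter (P? ∘ f) xs)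
filter-map P? f []       = refl
filter-map P? f (x ∷ xs) with does (P? (f x))
... | true  = cong (f x ∷_) (filter-map P? f xs)
... | false = filter-map P? f xs

lastOf : ℕ → List ℕ → ℕ
lastOf x []       = x
lastOf x (y ∷ ys) = lastOf y ys

lastOf-++ : ∀ x xs y ys → lastOf x (xs ++ y ∷ ys) ≡ lastOf y ys
lastOf-++ x []        y ys = refl
lastOf-++ x (x′ ∷ xs) y ys = lastOf-++ x′ xs y ys

lastOf-map : ∀ (f : ℕ → ℕ) x xs → lastOf (f x) (map f xs) ≡ f (lastOf x xs)
lastOf-map f x []        = refl
lastOf-map f x (x′ ∷ xs) = lastOf-map f x′ xs

-- Digits in base k

-- Positions count from the least significant digit, starting at 0: insertDigit b j c is c with
-- the digit j inserted at position b.
module Digits (k : ℕ) .{{_ : NonZero k}} where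

  digitAt : ℕ → ℕ → ℕ
  digitAt zero    c = c % k
  digitAt (suc e) c = digitAt e (c / k)

  insertDigit : ℕ → ℕ → ℕ → ℕ
  insertDigit zero    j c = c * k + j
  insertDigit (suc b) j c = insertDigit b j (c / k) * k + c % k

  digit≡digitAt : ∀ n d c → digit k n d c ≡ digitAt (n ∸ suc d) c
  digit≡digitAt n d c = sym (digitAt≡modN-divN (n ∸ suc d) c)
    where
    divN≡/ : ∀ m n .{{_ : NonZero n}} → divN m n ≡ m / n
    divN≡/ m (suc n) = refl
    modN≡% : ∀ m n .{{_ : NonZero n}} → modN m n ≡ m % n
    modN≡% m (suc n) = refl
    digitAt≡modN-divN : ∀ e c → digitAt e c ≡ modN (divN c (k ^ e)) k
    digitAt≡modN-divN zero    c = trans (cong (_% k) (sym (n/1≡n c))) (sym (modN≡% _ k))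
    digitAt≡modN-divN (suc e) c = begin
      digitAt e (c / k)                 ≡⟨ digitAt≡modN-divN e (c / k) ⟩
      modN (divN (c / k) (k ^ e)) k     ≡⟨ cong (λ x → modN x k) (divN≡/ (c / k) (k ^ e)) ⟩
      modN (c / k / k ^ e) k            ≡⟨ cong (λ x → modN x k) (m/n/o≡m/[n*o] c k (k ^ e)) ⟩
      modN (c / (k * k ^ e)) k          ≡⟨ cong (λ x → modN x k) (sym (divN≡/ c (k * k ^ e))) ⟩
      modN (divN c (k * k ^ e)) k       ∎
      where
      open ≡-Reasoning
      instance
        k^e≢0 : NonZero (k ^ e)
        k^e≢0 = m^n≢0 k e
        k^1+e≢0 : NonZero (k * k ^ e)
        k^1+e≢0 = m^n≢0 k (suc e)

  digitAt-insertDigit-above : ∀ {b e} j c → b ≤ e → j < k →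
                              digitAt (suc e) (insertDigit b j c) ≡ digitAt e c
  digitAt-insertDigit-above {zero} {e} j c _ j<k = cong (digitAt e) ([m*n+o]/n≡m c j<k)
  digitAt-insertDigit-above {suc b} {suc e} j c (s≤s b≤e) j<k = begin
    digitAt (suc e) ((insertDigit b j (c / k) * k + c % k) / k)
      ≡⟨ cong (digitAt (suc e)) ([m*n+o]/n≡m _ (m%n<n c k)) ⟩
    digitAt (suc e) (insertDigit b j (c / k)) ≡⟨ digitAt-insertDigit-above j (c / k) b≤e j<k ⟩
    digitAt e (c / k)                         ∎
    where open ≡-Reasoning

  digitAt-insertDigit-below : ∀ {b e} j c → e < b →
                              digitAt e (insertDigit b j c) ≡ digitAt e c
  digitAt-insertDigit-below {suc b} {zero}  j c _ = [m*n+o]%n≡o (insertDigit b j (c / k)) (m%n<n c k)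
  digitAt-insertDigit-below {suc b} {suc e} j c (s≤s e<b) = begin
    digitAt e ((insertDigit b j (c / k) * k + c % k) / k)
      ≡⟨ cong (digitAt e) ([m*n+o]/n≡m _ (m%n<n c k)) ⟩
    digitAt e (insertDigit b j (c / k)) ≡⟨ digitAt-insertDigit-below j (c / k) e<b ⟩
    digitAt e (c / k)                   ∎
    where open ≡-Reasoning

  insertDigit-strictMono : ∀ b {j} → j < k → insertDigit b j Preserves _<_ ⟶ _<_
  insertDigit-strictMono zero    {j} j<k c<c′ = +-monoˡ-< j (*-monoˡ-< k c<c′)
  insertDigit-strictMono (suc b) {j} j<k {c} {c′} c<c′ with m≤n⇒m<n∨m≡n (/-monoˡ-≤ k (<⇒≤ c<c′))
  ... | inj₁ q<q′ = m<n⇒m*o+p<n*o+q (insertDigit-strictMono b j<k q<q′) (m%n<n c k)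
  ... | inj₂ q≡q′ = subst (λ q → insertDigit b j (c / k) * k + c % k < insertDigit b j q * k + c′ % k) q≡q′
                          (+-monoʳ-< (insertDigit b j (c / k) * k) r<r′)
    where
    r<r′ : c % k < c′ % k
    r<r′ = +-cancelˡ-< (c / k * k) (c % k) (c′ % k) (begin-strict
      c / k * k + c % k   ≡⟨ +-comm (c / k * k) (c % k) ⟩
      c % k + c / k * k   ≡⟨ m≡m%n+[m/n]*n c k ⟨
      c                   <⟨ c<c′ ⟩
      c′                  ≡⟨ m≡m%n+[m/n]*n c′ k ⟩
      c′ % k + c′ / k * k ≡⟨ cong (λ q → c′ % k + q * k) q≡q′ ⟨
      c′ % k + c / k * k  ≡⟨ +-comm (c′ % k) (c / k * k) ⟩
      c / k * k + c′ % k  ∎)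
      where open ≤-Reasoning

  private
    block : ℕ → List ℕ
    block q = map (λ r → q * k + r) (upTo k)

    All-block : ∀ {P : ℕ → Set} q → (∀ {r} → r < k → P (q * k + r)) → All P (block q)
    All-block q h = map⁺ (applyUpTo⁺₁ id k h)

  filter-digitAt-upTo : ∀ b N {j} → j < k →
    filter (λ c → digitAt b c ≟ j) (upTo (N * k ^ b * k)) ≡ map (insertDigit b j) (upTo (N * k ^ b))
  filter-digitAt-upTo zero N {j} j<k = begin
    filter P? (upTo (N * 1 * k))                ≡⟨ cong (filter P?) (upTo-* (N * 1) k) ⟩
    filter P? (concatMap block (upTo (N * 1)))  ≡⟨ filter-concatMap P? block (upTo (N * 1)) ⟩
    concatMap (filter P? ∘ block) (upTo (N * 1)) ≡⟨ concatMap-cong filter-block (upTo (N * 1)) ⟩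
    concatMap (λ q → [ q * k + j ]) (upTo (N * 1)) ≡⟨ concatMap-singleton (λ q → q * k + j) (upTo (N * 1)) ⟩
    map (λ q → q * k + j) (upTo (N * 1))        ∎
    where
    open ≡-Reasoning
    P? = λ c → c % k ≟ j
    filter-block : ∀ q → filter P? (block q) ≡ [ q * k + j ]
    filter-block q = begin
      filter P? (block q)
        ≡⟨ cong (filter P?) (sym (concatMap-singleton (λ r → q * k + r) (upTo k))) ⟩
      filter P? (concatMap (λ r → [ q * k + r ]) (upTo k))
        ≡⟨ filter-concatMap-keyed (_% k) id j _ (upTo k) (applyUpTo⁺₁ id k (λ r<k → [m*n+o]%n≡o q r<k ∷ [])) ⟩
      concatMap (λ r → [ q * k + r ]) (filter (_≟ j) (upTo k))
        ≡⟨ cong (concatMap (λ r → [ q * k + r ])) (filter-≟-upTo j<k) ⟩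
      [ q * k + j ] ∎
  filter-digitAt-upTo (suc b) N {j} j<k = begin
    filter P? (upTo (N * k ^ suc b * k))
      ≡⟨ cong (filter P?) (upTo-* (N * k ^ suc b) k) ⟩
    filter P? (concatMap block (upTo (N * k ^ suc b)))
      ≡⟨ filter-concatMap-keyed (digitAt (suc b)) (digitAt b) j block (upTo (N * k ^ suc b))
           (applyUpTo⁺₂ id _ (λ q → All-block q (λ r<k → cong (digitAt b) ([m*n+o]/n≡m q r<k)))) ⟩
    concatMap block (filter Q? (upTo (N * k ^ suc b)))
      ≡⟨ cong (λ m → concatMap block (filter Q? (upTo m))) N*k^1+b≡N*k^b*k ⟩
    concatMap block (filter Q? (upTo (N * k ^ b * k)))
      ≡⟨ cong (concatMap block) (filter-digitAt-upTo b N j<k) ⟩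
    concatMap block (map (insertDigit b j) (upTo (N * k ^ b)))
      ≡⟨ concatMap-map block (insertDigit b j) (upTo (N * k ^ b)) ⟩
    concatMap (block ∘ insertDigit b j) (upTo (N * k ^ b))
      ≡⟨ concatMap-cong insert-block (upTo (N * k ^ b)) ⟩
    concatMap (map (insertDigit (suc b) j) ∘ block) (upTo (N * k ^ b))
      ≡⟨ sym (map-concatMap (insertDigit (suc b) j) block (upTo (N * k ^ b))) ⟩
    map (insertDigit (suc b) j) (concatMap block (upTo (N * k ^ b)))
      ≡⟨ cong (map (insertDigit (suc b) j)) (sym (upTo-* (N * k ^ b) k)) ⟩
    map (insertDigit (suc b) j) (upTo (N * k ^ b * k))
      ≡⟨ cong (λ m → map (insertDigit (suc b) j) (upTo m)) (sym N*k^1+b≡N*k^b*k) ⟩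
    map (insertDigit (suc b) j) (upTo (N * k ^ suc b)) ∎
    where
    open ≡-Reasoning
    P? = λ c → digitAt (suc b) c ≟ j
    Q? = λ c → digitAt b c ≟ j
    N*k^1+b≡N*k^b*k : N * k ^ suc b ≡ N * k ^ b * k
    N*k^1+b≡N*k^b*k = trans (cong (N *_) (*-comm k (k ^ b))) (sym (*-assoc N (k ^ b) k))
    insert-block : ∀ q → block (insertDigit b j q) ≡ map (insertDigit (suc b) j) (block q)
    insert-block q = trans (map-cong-local (applyUpTo⁺₁ id k (λ r<k → sym (cong₂ (λ x y → insertDigit b j x * k + y)
                                                                           ([m*n+o]/n≡m q r<k) ([m*n+o]%n≡o q r<k)))))
                           (map-∘ (upTo k))

-- Descents and inversions of concatenations

module _ {f : ℕ → ℕ} (f-mono : f Preserves _<_ ⟶ _<_) where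

  strictMono-reflects-< : ∀ {x y} → f x < f y → x < y
  strictMono-reflects-< {x} {y} fx<fy with x <? y
  ... | yes x<y = x<y
  ... | no x≮y with m≤n⇒m<n∨m≡n (≮⇒≥ x≮y)
  ...   | inj₁ y<x  = contradiction (f-mono y<x) (<-asym fx<fy)
  ...   | inj₂ refl = contradiction fx<fy (<-irrefl refl)

countBelow : ℕ → List ℕ → ℕ
countBelow x ys = length (filter (_<? x) ys)

inversionsBetween : List ℕ → List ℕ → ℕ
inversionsBetween xs ys = sum (map (λ x → countBelow x ys) xs)

descentIndicator : ℕ → ℕ → ℕ
descentIndicator p y = if does (y <? p) then 1 else 0

descents-++ : ∀ x xs y ys →
  descents (x ∷ xs ++ y ∷ ys) ≡ descents (x ∷ xs) + descentIndicator (lastOf x xs) y + descents (y ∷ ys)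
descents-++ x []        y ys = refl
descents-++ x (x′ ∷ xs) y ys =
  trans (cong (descentIndicator x x′ +_) (descents-++ x′ xs y ys))
        (reassoc (descentIndicator x x′) (descents (x′ ∷ xs)) (descentIndicator (lastOf x′ xs) y) (descents (y ∷ ys)))
  where
  reassoc : ∀ a b c d → a + (b + c + d) ≡ a + b + c + d
  reassoc = solve-∀

descents-++-≥ : ∀ xs ys → descents xs + descents ys ≤ descents (xs ++ ys)
descents-++-≥ []       ys       = ≤-refl
descents-++-≥ (x ∷ xs) []       = ≤-reflexive (trans (+-identityʳ _) (cong descents (sym (++-identityʳ (x ∷ xs)))))
descents-++-≥ (x ∷ xs) (y ∷ ys) = begin
  descents (x ∷ xs) + descents (y ∷ ys)
    ≤⟨ +-monoˡ-≤ (descents (y ∷ ys)) (m≤m+n (descents (x ∷ xs)) (descentIndicator (lastOf x xs) y)) ⟩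
  descents (x ∷ xs) + descentIndicator (lastOf x xs) y + descents (y ∷ ys)
    ≡⟨ descents-++ x xs y ys ⟨
  descents (x ∷ xs ++ y ∷ ys) ∎
  where open ≤-Reasoning

countBelow-++ : ∀ x ys zs → countBelow x (ys ++ zs) ≡ countBelow x ys + countBelow x zs
countBelow-++ x ys zs = trans (cong length (filter-++ (_<? x) ys zs)) (length-++ (filter (_<? x) ys))

inversions-++ : ∀ xs ys → inversions (xs ++ ys) ≡ inversions xs + inversions ys + inversionsBetween xs ys
inversions-++ []       ys = sym (+-identityʳ (inversions ys))
inversions-++ (x ∷ xs) ys = trans (cong₂ _+_ (countBelow-++ x xs ys) (inversions-++ xs ys))
                                  (reassoc (countBelow x xs) (countBelow x ys) (inversions xs) (inversions ys) (inversionsBetween xs ys))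
  where
  reassoc : ∀ a b c d e → (a + b) + (c + d + e) ≡ (a + c) + d + (b + e)
  reassoc = solve-∀

inversions-++-≥ : ∀ xs ys → inversions xs + inversions ys ≤ inversions (xs ++ ys)
inversions-++-≥ xs ys = subst (inversions xs + inversions ys ≤_) (sym (inversions-++ xs ys)) (m≤m+n _ _)

inversionsBetween-++ˡ : ∀ xs ys zs → inversionsBetween (xs ++ ys) zs ≡ inversionsBetween xs zs + inversionsBetween ys zs
inversionsBetween-++ˡ xs ys zs = trans (cong sum (map-++ (λ x → countBelow x zs) xs ys)) (sum-++ (map (λ x → countBelow x zs) xs) _)

inversionsBetween-++ʳ : ∀ xs ys zs → inversionsBetween xs (ys ++ zs) ≡ inversionsBetween xs ys + inversionsBetween xs zs
inversionsBetween-++ʳ []       ys zs = refl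
inversionsBetween-++ʳ (x ∷ xs) ys zs = trans (cong₂ _+_ (countBelow-++ x ys zs) (inversionsBetween-++ʳ xs ys zs))
                                             (reassoc (countBelow x ys) (countBelow x zs) (inversionsBetween xs ys) (inversionsBetween xs zs))
  where
  reassoc : ∀ a b c d → (a + b) + (c + d) ≡ (a + c) + (b + d)
  reassoc = solve-∀

inversionsBetween-[] : ∀ xs → inversionsBetween xs [] ≡ 0
inversionsBetween-[] []       = refl
inversionsBetween-[] (x ∷ xs) = inversionsBetween-[] xs

countBelow-map : ∀ {f g f′ : ℕ → ℕ} → (∀ {x y} → g y < f x → y < f′ x) → (∀ {x y} → y < f′ x → g y < f x) →
                 ∀ x ys → countBelow (f x) (map g ys) ≡ countBelow (f′ x) ys
countBelow-map {f} {g} {f′} ⇒ ⇐ x ys = begin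
  length (filter (_<? f x) (map g ys))         ≡⟨ cong length (filter-map (_<? f x) g ys) ⟩
  length (map g (filter (λ y → g y <? f x) ys)) ≡⟨ length-map g (filter (λ y → g y <? f x) ys) ⟩
  length (filter (λ y → g y <? f x) ys)         ≡⟨ cong length (filter-≐ (λ y → g y <? f x) (_<? f′ x) (⇒ , ⇐) ys) ⟩
  length (filter (_<? f′ x) ys)                 ∎
  where open ≡-Reasoning

inversionsBetween-map : ∀ {f g f′ : ℕ → ℕ} → (∀ {x y} → g y < f x → y < f′ x) → (∀ {x y} → y < f′ x → g y < f x) →
                        ∀ xs ys → inversionsBetween (map f xs) (map g ys) ≡ inversionsBetween (map f′ xs) ys
inversionsBetween-map ⇒ ⇐ []       ys = refl
inversionsBetween-map {f} {g} {f′} ⇒ ⇐ (x ∷ xs) ys =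
  cong₂ _+_ (countBelow-map {f} {g} {f′} ⇒ ⇐ x ys) (inversionsBetween-map {f} {g} {f′} ⇒ ⇐ xs ys)

module _ {f : ℕ → ℕ} (f-mono : f Preserves _<_ ⟶ _<_) where

  descents-map : ∀ xs → descents (map f xs) ≡ descents xs
  descents-map []           = refl
  descents-map (x ∷ [])     = refl
  descents-map (x ∷ y ∷ ys) =
    cong₂ _+_ (cong (λ b → if b then 1 else 0) (does-⇔ (f y <? f x) (y <? x) (strictMono-reflects-< f-mono) f-mono))
              (descents-map (y ∷ ys))

  inversions-map : ∀ xs → inversions (map f xs) ≡ inversions xs
  inversions-map []       = refl
  inversions-map (x ∷ xs) =
    cong₂ _+_ (countBelow-map {f} {f} {id} (λ {a} {b} → strictMono-reflects-< f-mono {b} {a}) (λ {a} {b} → f-mono {b} {a}) x xs)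
              (inversions-map xs)

module _ (f : ℕ → ℕ → ℕ) (X : List ℕ) where

  descents-concatMap-≥ : ∀ J → All (λ j → f j Preserves _<_ ⟶ _<_) J →
                         length J * descents X ≤ descents (concatMap (λ j → map (f j) X) J)
  descents-concatMap-≥ []       []                 = z≤n
  descents-concatMap-≥ (j ∷ J) (f-mono ∷ fs-mono) =
    ≤-trans (+-mono-≤ (≤-reflexive (sym (descents-map f-mono X))) (descents-concatMap-≥ J fs-mono))
            (descents-++-≥ (map (f j) X) _)

  inversions-concatMap-≥ : ∀ J → All (λ j → f j Preserves _<_ ⟶ _<_) J →
                           length J * inversions X ≤ inversions (concatMap (λ j → map (f j) X) J)
  inversions-concatMap-≥ []       []                 = z≤n
  inversions-concatMap-≥ (j ∷ J) (f-mono ∷ fs-mono) =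
    ≤-trans (+-mono-≤ (≤-reflexive (sym (inversions-map f-mono X))) (inversions-concatMap-≥ J fs-mono))
            (inversions-++-≥ (map (f j) X) _)

-- Firing layer by layer

module Firing (k : ℕ) where

  -- finalLayer k n w = fireLayers n (λ i → toℕ (w ⟨$⟩ʳ i)) (layer1 k n) (allFin n)
  fireLayers : ∀ {I : Set} → ℕ → (I → ℕ) → List (List ℕ) → List I → List (List ℕ)
  fireLayers N pos = foldl (λ L i → concatMap (fireVertex k N (pos i)) L)

  fireLayers-[] : ∀ {I : Set} N (pos : I → ℕ) is → fireLayers N pos [] is ≡ []
  fireLayers-[] N pos []       = refl
  fireLayers-[] N pos (i ∷ is) = fireLayers-[] N pos is

  fireLayers-++ : ∀ {I : Set} N (pos : I → ℕ) L L′ is →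
                  fireLayers N pos (L ++ L′) is ≡ fireLayers N pos L is ++ fireLayers N pos L′ is
  fireLayers-++ N pos L L′ []       = refl
  fireLayers-++ N pos L L′ (i ∷ is) =
    trans (cong (λ L″ → fireLayers N pos L″ is) (concatMap-++ (fireVertex k N (pos i)) L L′))
          (fireLayers-++ N pos _ _ is)

  fireLayers-vertexwise : ∀ {I : Set} N (pos : I → ℕ) L is →
                          fireLayers N pos L is ≡ concatMap (λ X → fireLayers N pos [ X ] is) L
  fireLayers-vertexwise N pos []      is = fireLayers-[] N pos is
  fireLayers-vertexwise N pos (X ∷ L) is =
    trans (fireLayers-++ N pos [ X ] L is) (cong (fireLayers N pos [ X ] is ++_) (fireLayers-vertexwise N pos L is))

  module _ (N N′ d d′ : ℕ) (f : ℕ → ℕ) (digit-f : ∀ c → digit k N′ d′ (f c) ≡ digit k N d c) where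

    fireVertex-relabel : ∀ X → fireVertex k N′ d′ (map f X) ≡ map (map f) (fireVertex k N d X)
    fireVertex-relabel X = trans (map-cong filter-relabel (upTo k)) (map-∘ (upTo k))
      where
      filter-relabel : ∀ j → filter (λ c → digit k N′ d′ c ≟ j) (map f X) ≡ map f (filter (λ c → digit k N d c ≟ j) X)
      filter-relabel j = trans (filter-map (λ c → digit k N′ d′ c ≟ j) f X)
                               (cong (map f) (filter-≐ _ _ ((λ e → trans (sym (digit-f _)) e) , (λ e → trans (digit-f _) e)) X))

    fireLayer-relabel : ∀ L → concatMap (fireVertex k N′ d′) (map (map f) L) ≡ map (map f) (concatMap (fireVertex k N d) L)
    fireLayer-relabel L = begin
      concatMap (fireVertex k N′ d′) (map (map f) L)           ≡⟨ concatMap-map (fireVertex k N′ d′) (map f) L ⟩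
      concatMap (fireVertex k N′ d′ ∘ map f) L                 ≡⟨ concatMap-cong fireVertex-relabel L ⟩
      concatMap (map (map f) ∘ fireVertex k N d) L             ≡⟨ sym (map-concatMap (map f) (fireVertex k N d) L) ⟩
      map (map f) (concatMap (fireVertex k N d) L)             ∎
      where open ≡-Reasoning

  fireLayers-relabel : ∀ {I : Set} N N′ (pos : I → ℕ) (pos′ : I → ℕ) (f : ℕ → ℕ) →
                       (∀ i c → digit k N′ (pos′ i) (f c) ≡ digit k N (pos i) c) →
                       ∀ L is → fireLayers N′ pos′ (map (map f) L) is ≡ map (map f) (fireLayers N pos L is)
  fireLayers-relabel N N′ pos pos′ f digit-f L []       = refl
  fireLayers-relabel N N′ pos pos′ f digit-f L (i ∷ is) =
    trans (cong (λ L′ → fireLayers N′ pos′ L′ is) (fireLayer-relabel N N′ (pos i) (pos′ i) f (digit-f i) L))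
          (fireLayers-relabel N N′ pos pos′ f digit-f (concatMap (fireVertex k N (pos i)) L) is)

toℕ-punchIn-< : ∀ {m} (p : Fin (suc m)) (q : Fin m) → toℕ q < toℕ p → toℕ (punchIn p q) ≡ toℕ q
toℕ-punchIn-< (suc p) zero    _           = refl
toℕ-punchIn-< (suc p) (suc q) (s≤s q<p) = cong suc (toℕ-punchIn-< p q q<p)

toℕ-punchIn-≥ : ∀ {m} (p : Fin (suc m)) (q : Fin m) → toℕ p ≤ toℕ q → toℕ (punchIn p q) ≡ suc (toℕ q)
toℕ-punchIn-≥ zero    q       _           = refl
toℕ-punchIn-≥ (suc p) (suc q) (s≤s p≤q) = cong suc (toℕ-punchIn-≥ p q p≤q)

module Decomposition (k : ℕ) .{{_ : NonZero k}} where
  open Digits k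
  open Firing k

  spread : (ℕ → ℕ → ℕ) → List ℕ → List ℕ
  spread f X = concatMap (λ j → map (f j) X) (upTo k)

  digit-insertDigit-punchIn : ∀ {n} (p : Fin (suc n)) (q : Fin n) {j} c → j < k →
    digit k (suc n) (toℕ (punchIn p q)) (insertDigit (n ∸ toℕ p) j c) ≡ digit k n (toℕ q) c
  digit-insertDigit-punchIn {n} p q {j} c j<k with toℕ q <? toℕ p
  ... | yes q<p = begin
    digit k (suc n) (toℕ (punchIn p q)) x   ≡⟨ cong (λ d → digit k (suc n) d x) (toℕ-punchIn-< p q q<p) ⟩
    digit k (suc n) (toℕ q) x               ≡⟨ digit≡digitAt (suc n) (toℕ q) x ⟩
    digitAt (n ∸ toℕ q) x                   ≡⟨ cong (λ e → digitAt e x) (+-∸-assoc 1 (toℕ<n q)) ⟩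
    digitAt (suc (n ∸ suc (toℕ q))) x       ≡⟨ digitAt-insertDigit-above j c (∸-monoʳ-≤ n q<p) j<k ⟩
    digitAt (n ∸ suc (toℕ q)) c             ≡⟨ sym (digit≡digitAt n (toℕ q) c) ⟩
    digit k n (toℕ q) c                     ∎
    where
    open ≡-Reasoning
    x = insertDigit (n ∸ toℕ p) j c
  ... | no q≮p = begin
    digit k (suc n) (toℕ (punchIn p q)) x   ≡⟨ cong (λ d → digit k (suc n) d x) (toℕ-punchIn-≥ p q p≤q) ⟩
    digit k (suc n) (suc (toℕ q)) x         ≡⟨ digit≡digitAt (suc n) (suc (toℕ q)) x ⟩
    digitAt (n ∸ suc (toℕ q)) x             ≡⟨ digitAt-insertDigit-below j c (∸-monoʳ-< (s≤s p≤q) (toℕ<n q)) ⟩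
    digitAt (n ∸ suc (toℕ q)) c             ≡⟨ sym (digit≡digitAt n (toℕ q) c) ⟩
    digit k n (toℕ q) c                     ∎
    where
    open ≡-Reasoning
    x = insertDigit (n ∸ toℕ p) j c
    p≤q : toℕ p ≤ toℕ q
    p≤q = ≮⇒≥ q≮p

  fireVertex-root : ∀ n p → p ≤ n →
    fireVertex k (suc n) p (upTo (k ^ suc n)) ≡ map (λ j → map (insertDigit (n ∸ p) j) (upTo (k ^ n))) (upTo k)
  fireVertex-root n p p≤n = map-cong-local (applyUpTo⁺₁ id k filter-root)
    where
    open ≡-Reasoning
    k^n≡k^p*k^b : k ^ n ≡ k ^ p * k ^ (n ∸ p)
    k^n≡k^p*k^b = trans (cong (k ^_) (sym (m+[n∸m]≡n p≤n))) (^-distribˡ-+-* k p (n ∸ p))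
    filter-root : ∀ {j} → j < k →
      filter (λ c → digit k (suc n) p c ≟ j) (upTo (k ^ suc n)) ≡ map (insertDigit (n ∸ p) j) (upTo (k ^ n))
    filter-root {j} j<k = begin
      filter (λ c → digit k (suc n) p c ≟ j) (upTo (k ^ suc n))
        ≡⟨ filter-≐ (λ c → digit k (suc n) p c ≟ j) (λ c → digitAt (n ∸ p) c ≟ j)
                    ((λ e → trans (sym (digit≡digitAt (suc n) p _)) e) , (λ e → trans (digit≡digitAt (suc n) p _) e))
                    (upTo (k ^ suc n)) ⟩
      filter (λ c → digitAt (n ∸ p) c ≟ j) (upTo (k * k ^ n))
        ≡⟨ cong (λ m → filter (λ c → digitAt (n ∸ p) c ≟ j) (upTo m)) (trans (*-comm k (k ^ n)) (cong (_* k) k^n≡k^p*k^b)) ⟩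
      filter (λ c → digitAt (n ∸ p) c ≟ j) (upTo (k ^ p * k ^ (n ∸ p) * k))
        ≡⟨ filter-digitAt-upTo (n ∸ p) (k ^ p) j<k ⟩
      map (insertDigit (n ∸ p) j) (upTo (k ^ p * k ^ (n ∸ p)))
        ≡⟨ cong (λ m → map (insertDigit (n ∸ p) j) (upTo m)) (sym k^n≡k^p*k^b) ⟩
      map (insertDigit (n ∸ p) j) (upTo (k ^ n)) ∎

  config-suc : ∀ n (w : Permutation′ (suc n)) →
    config k (suc n) w ≡ spread (insertDigit (n ∸ toℕ (w ⟨$⟩ʳ zero))) (config k n (remove zero w))
  config-suc n w = begin
    concat (fireLayers (suc n) pos (fireVertex k (suc n) (toℕ p) (upTo (k ^ suc n)) ++ []) (tabulate suc))
      ≡⟨ cong₂ (λ L is → concat (fireLayers (suc n) pos L is))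
               (trans (++-identityʳ _) (fireVertex-root n (toℕ p) (s≤s⁻¹ (toℕ<n p)))) (sym (map-tabulate id suc)) ⟩
    concat (fireLayers (suc n) pos (map root (upTo k)) (map suc (allFin n)))
      ≡⟨ cong concat (foldl-map _ suc (map root (upTo k)) (allFin n)) ⟩
    concat (fireLayers (suc n) (pos ∘ suc) (map root (upTo k)) (allFin n))
      ≡⟨ cong concat (fireLayers-vertexwise (suc n) (pos ∘ suc) (map root (upTo k)) (allFin n)) ⟩
    concat (concatMap (λ X → fireLayers (suc n) (pos ∘ suc) [ X ] (allFin n)) (map root (upTo k)))
      ≡⟨ cong concat (concatMap-map _ root (upTo k)) ⟩
    concat (concatMap (λ j → fireLayers (suc n) (pos ∘ suc) [ root j ] (allFin n)) (upTo k))
      ≡⟨ cong (concat ∘ concat) (map-cong-local (applyUpTo⁺₁ id k relabel)) ⟩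
    concat (concatMap (λ j → map (map (ins j)) (finalLayer k n w′)) (upTo k))
      ≡⟨ sym (concat-concat (map (λ j → map (map (ins j)) (finalLayer k n w′)) (upTo k))) ⟩
    concat (map concat (map (λ j → map (map (ins j)) (finalLayer k n w′)) (upTo k)))
      ≡⟨ cong concat (sym (map-∘ (upTo k))) ⟩
    concatMap (λ j → concat (map (map (ins j)) (finalLayer k n w′))) (upTo k)
      ≡⟨ concatMap-cong (λ j → concat-map (finalLayer k n w′)) (upTo k) ⟩
    spread ins (config k n w′) ∎
    where
    open ≡-Reasoning
    p = w ⟨$⟩ʳ zero
    w′ = remove zero w
    pos : Fin (suc n) → ℕ
    pos i = toℕ (w ⟨$⟩ʳ i)
    ins = insertDigit (n ∸ toℕ p)
    root : ℕ → List ℕ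
    root j = map (ins j) (upTo (k ^ n))
    relabel : ∀ {j} → j < k → fireLayers (suc n) (pos ∘ suc) [ root j ] (allFin n) ≡ map (map (ins j)) (finalLayer k n w′)
    relabel {j} j<k = fireLayers-relabel n (suc n) (λ i → toℕ (w′ ⟨$⟩ʳ i)) (pos ∘ suc) (ins j)
      (λ i c → trans (cong (λ d → digit k (suc n) (toℕ d) (ins j c)) (punchIn-permute w zero i))
                     (digit-insertDigit-punchIn p (w′ ⟨$⟩ʳ i) c j<k))
      [ upTo (k ^ n) ] (allFin n)

-- Permutations decreasing from a position on

DecreasingFrom : ∀ n → Permutation′ n → ℕ → Set
DecreasingFrom n w i₀ = (i j : Fin n) → toℕ j ≡ suc (toℕ i) → i₀ ≤ suc (toℕ i) → toℕ (w ⟨$⟩ʳ j) < toℕ (w ⟨$⟩ʳ i)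

DecreasingFrom-mono : ∀ {n} {w : Permutation′ n} {i₀ i₁} → i₀ ≤ i₁ → DecreasingFrom n w i₀ → DecreasingFrom n w i₁
DecreasingFrom-mono i₀≤i₁ dec i j j≡1+i i₁≤1+i = dec i j j≡1+i (≤-trans i₀≤i₁ i₁≤1+i)

DecreasingFrom-remove : ∀ {n} {w : Permutation′ (suc n)} {i₀} → DecreasingFrom (suc n) w (suc i₀) → DecreasingFrom n (remove zero w) i₀
DecreasingFrom-remove {w = w} dec i j j≡1+i i₀≤1+i with toℕ (remove zero w ⟨$⟩ʳ j) <? toℕ (remove zero w ⟨$⟩ʳ i)
... | yes lt = lt
... | no ¬lt = contradiction (punchIn-mono-≤ (w ⟨$⟩ʳ zero) _ _ (≮⇒≥ ¬lt)) (<⇒≱ punched)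
  where
  punched : toℕ (punchIn (w ⟨$⟩ʳ zero) (remove zero w ⟨$⟩ʳ j)) < toℕ (punchIn (w ⟨$⟩ʳ zero) (remove zero w ⟨$⟩ʳ i))
  punched = subst₂ (λ a b → toℕ a < toℕ b) (punchIn-permute w zero j) (punchIn-permute w zero i)
                   (dec (suc i) (suc j) (cong suc j≡1+i) (s≤s i₀≤1+i))

decreasing-head : ∀ {n} (w : Permutation′ (suc n)) → DecreasingFrom (suc n) w 1 → toℕ (w ⟨$⟩ʳ zero) ≡ n
decreasing-head {n} w dec = ≤-antisym (s≤s⁻¹ (toℕ<n (w ⟨$⟩ʳ zero))) (distance-to-end n zero refl)
  where
  distance-to-end : ∀ d (i : Fin (suc n)) → toℕ i + d ≡ n → d ≤ toℕ (w ⟨$⟩ʳ i)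
  distance-to-end zero    i _         = z≤n
  distance-to-end (suc d) i i+1+d≡n = ≤-<-trans (distance-to-end d j (trans (cong (_+ d) toℕ-j) 1+i+d≡n)) (dec i j toℕ-j (s≤s z≤n))
    where
    1+i+d≡n : suc (toℕ i) + d ≡ n
    1+i+d≡n = trans (sym (+-suc (toℕ i) d)) i+1+d≡n
    1+i<1+n : suc (toℕ i) < suc n
    1+i<1+n = s≤s (subst (suc (toℕ i) ≤_) 1+i+d≡n (m≤m+n (suc (toℕ i)) d))
    j = Fin.fromℕ< 1+i<1+n
    toℕ-j : toℕ j ≡ suc (toℕ i)
    toℕ-j = toℕ-fromℕ< 1+i<1+n

-- The fully decreasing case

module Blocks (k : ℕ) where

  block : ℕ → List ℕ → List ℕ
  block a X = map (λ c → c * k + a) X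

  blocks : ℕ → ℕ → List ℕ → List ℕ
  blocks a zero    X = []
  blocks a (suc m) X = block a X ++ blocks (suc a) m X

  block-strictMono : ∀ {a} → a < k → (λ c → c * k + a) Preserves _<_ ⟶ _<_
  block-strictMono {a} a<k y<x = m<n⇒m*o+p<n*o+q y<x a<k

  block-<⇒< : ∀ {a b x y} → a ≤ b → y * k + b < x * k + a → y < x
  block-<⇒< {a} {b} {x} {y} a≤b lt with y <? x
  ... | yes y<x = y<x
  ... | no y≮x  = contradiction lt (≤⇒≯ (+-mono-≤ (*-monoˡ-≤ k (≮⇒≥ y≮x)) a≤b))

  block-<⇒≤ : ∀ {a b x y} → b ≤ k → y * k + a < x * k + b → y < suc x
  block-<⇒≤ {a} {b} {x} {y} b≤k lt with y <? suc x
  ... | yes y≤x = y≤x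
  ... | no y≰x  = contradiction lt (≤⇒≯ (begin
    x * k + b      ≤⟨ +-monoʳ-≤ (x * k) b≤k ⟩
    x * k + k      ≡⟨ +-comm (x * k) k ⟩
    suc x * k      ≤⟨ *-monoˡ-≤ k (≮⇒≥ y≰x) ⟩
    y * k          ≤⟨ m≤m+n (y * k) a ⟩
    y * k + a      ∎))
    where open ≤-Reasoning

  block-≤⇒< : ∀ {a b x y} → a < b → y < suc x → y * k + a < x * k + b
  block-≤⇒< {a} {b} {x} {y} a<b (s≤s y≤x) = <-≤-trans (+-monoʳ-< (y * k) a<b) (+-monoˡ-≤ b (*-monoˡ-≤ k y≤x))

  module _ (X : List ℕ) where

    private
      C L : ℕ
      C = inversionsBetween X X
      L = inversionsBetween (map suc X) X

    inversionsBetween-block-block-≤ : ∀ {a b} → a ≤ b → b < k → inversionsBetween (block a X) (block b X) ≡ C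
    inversionsBetween-block-block-≤ {a} {b} a≤b b<k =
      trans (inversionsBetween-map {λ c → c * k + a} {λ c → c * k + b} {id} (block-<⇒< a≤b) (λ y<x → m<n⇒m*o+p<n*o+q y<x b<k) X X)
            (cong (λ Y → inversionsBetween Y X) (map-id X))

    inversionsBetween-block-block-> : ∀ {a b} → a < b → b ≤ k → inversionsBetween (block b X) (block a X) ≡ L
    inversionsBetween-block-block-> {a} {b} a<b b≤k =
      inversionsBetween-map {λ c → c * k + b} {λ c → c * k + a} {suc} (block-<⇒≤ b≤k) (block-≤⇒< a<b) X X

    inversionsBetween-block-blocks : ∀ {a} m b → a ≤ b → b + m ≤ k → inversionsBetween (block a X) (blocks b m X) ≡ m * C
    inversionsBetween-block-blocks zero    b _   _  = inversionsBetween-[] (block _ X)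
    inversionsBetween-block-blocks {a} (suc m) b a≤b le = begin
      inversionsBetween (block a X) (block b X ++ blocks (suc b) m X)
        ≡⟨ inversionsBetween-++ʳ (block a X) (block b X) (blocks (suc b) m X) ⟩
      inversionsBetween (block a X) (block b X) + inversionsBetween (block a X) (blocks (suc b) m X)
        ≡⟨ cong₂ _+_ (inversionsBetween-block-block-≤ a≤b (≤-trans (s≤s (m≤m+n b m)) le′))
                     (inversionsBetween-block-blocks m (suc b) (m≤n⇒m≤1+n a≤b) le′) ⟩
      C + m * C ∎
      where
      open ≡-Reasoning
      le′ : suc b + m ≤ k
      le′ = subst (_≤ k) (+-suc b m) le

    inversionsBetween-blocks-block : ∀ {a} m b → a < b → b + m ≤ suc k → inversionsBetween (blocks b m X) (block a X) ≡ m * L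
    inversionsBetween-blocks-block zero    b _   _  = refl
    inversionsBetween-blocks-block {a} (suc m) b a<b le = begin
      inversionsBetween (block b X ++ blocks (suc b) m X) (block a X)
        ≡⟨ inversionsBetween-++ˡ (block b X) (blocks (suc b) m X) (block a X) ⟩
      inversionsBetween (block b X) (block a X) + inversionsBetween (blocks (suc b) m X) (block a X)
        ≡⟨ cong₂ _+_ (inversionsBetween-block-block-> a<b (s≤s⁻¹ (≤-trans (s≤s (m≤m+n b m)) le′)))
                     (inversionsBetween-blocks-block m (suc b) (m<n⇒m<1+n a<b) le′) ⟩
      L + m * L ∎
      where
      open ≡-Reasoning
      le′ : suc b + m ≤ suc k
      le′ = subst (_≤ suc k) (+-suc b m) le

    inversions-blocks : ∀ m a → a + m ≤ k → inversions (blocks a m X) ≡ m * inversions X + triangular m * C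
    inversions-blocks zero    a _  = refl
    inversions-blocks (suc m) a le = begin
      inversions (block a X ++ blocks (suc a) m X)
        ≡⟨ inversions-++ (block a X) (blocks (suc a) m X) ⟩
      inversions (block a X) + inversions (blocks (suc a) m X) + inversionsBetween (block a X) (blocks (suc a) m X)
        ≡⟨ cong₂ _+_ (cong₂ _+_ (inversions-map (block-strictMono a<k) X) (inversions-blocks m (suc a) le′))
                     (inversionsBetween-block-blocks m (suc a) (n≤1+n a) le′) ⟩
      inversions X + (m * inversions X + triangular m * C) + m * C
        ≡⟨ reassoc (inversions X) m (triangular m) C ⟩
      suc m * inversions X + triangular (suc m) * C ∎
      where
      open ≡-Reasoning
      le′ : suc a + m ≤ k
      le′ = subst (_≤ k) (+-suc a m) le
      a<k : a < k
      a<k = ≤-trans (s≤s (m≤m+n a m)) le′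
      reassoc : ∀ I m t C → I + (m * I + t * C) + m * C ≡ (I + m * I) + (m + t) * C
      reassoc = solve-∀

    inversionsBetween-blocks-blocks : ∀ e Δ → e ≤ 1 → (∀ {b} → b < k → inversionsBetween (block (b + e) X) (block b X) ≡ Δ) →
      ∀ m a → a + m ≤ k → inversionsBetween (blocks (a + e) m X) (blocks a m X) ≡ m * Δ + triangular m * (C + L)
    inversionsBetween-blocks-blocks e Δ e≤1 diagonal zero    a _  = refl
    inversionsBetween-blocks-blocks e Δ e≤1 diagonal (suc m) a le = begin
      inversionsBetween (block (a + e) X ++ R′) (block a X ++ R)
        ≡⟨ inversionsBetween-++ˡ (block (a + e) X) R′ (block a X ++ R) ⟩
      inversionsBetween (block (a + e) X) (block a X ++ R) + inversionsBetween R′ (block a X ++ R)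
        ≡⟨ cong₂ _+_ (inversionsBetween-++ʳ (block (a + e) X) (block a X) R) (inversionsBetween-++ʳ R′ (block a X) R) ⟩
      (inversionsBetween (block (a + e) X) (block a X) + inversionsBetween (block (a + e) X) R)
        + (inversionsBetween R′ (block a X) + inversionsBetween R′ R)
        ≡⟨ cong₂ _+_ (cong₂ _+_ (diagonal a<k) (inversionsBetween-block-blocks m (suc a) a+e≤1+a le′))
                     (cong₂ _+_ (inversionsBetween-blocks-block m (suc a + e) (s≤s (m≤m+n a e)) bound)
                                (inversionsBetween-blocks-blocks e Δ e≤1 diagonal m (suc a) le′)) ⟩
      (Δ + m * C) + (m * L + (m * Δ + triangular m * (C + L)))
        ≡⟨ reassoc Δ C L m (triangular m) ⟩
      suc m * Δ + triangular (suc m) * (C + L) ∎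
      where
      open ≡-Reasoning
      R  = blocks (suc a) m X
      R′ = blocks (suc a + e) m X
      le′ : suc a + m ≤ k
      le′ = subst (_≤ k) (+-suc a m) le
      a<k : a < k
      a<k = ≤-trans (s≤s (m≤m+n a m)) le′
      a+e≤1+a : a + e ≤ suc a
      a+e≤1+a = subst (a + e ≤_) (+-comm a 1) (+-monoʳ-≤ a e≤1)
      bound : suc a + e + m ≤ suc k
      bound = s≤s (≤-trans (+-monoˡ-≤ m a+e≤1+a) le′)
      reassoc : ∀ Δ C L m t → (Δ + m * C) + (m * L + (m * Δ + t * (C + L))) ≡ (Δ + m * Δ) + (m + t) * (C + L)
      reassoc = solve-∀

    inversionsBetween-blocks-self : inversionsBetween (blocks 0 k X) (blocks 0 k X) ≡ k * C + triangular k * (C + L)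
    inversionsBetween-blocks-self = inversionsBetween-blocks-blocks 0 C z≤n
      (λ {b} b<k → inversionsBetween-block-block-≤ (≤-reflexive (+-identityʳ b)) b<k) k 0 ≤-refl

    inversionsBetween-blocks-shifted : inversionsBetween (blocks 1 k X) (blocks 0 k X) ≡ k * L + triangular k * (C + L)
    inversionsBetween-blocks-shifted = inversionsBetween-blocks-blocks 1 L ≤-refl
      (λ {b} b<k → inversionsBetween-block-block-> (subst (b <_) (+-comm 1 b) ≤-refl) (subst (_≤ k) (+-comm 1 b) b<k)) k 0 ≤-refl

  map-suc-blocks : ∀ m a X → map suc (blocks a m X) ≡ blocks (suc a) m X
  map-suc-blocks zero    a X = refl
  map-suc-blocks (suc m) a X = begin
    map suc (block a X ++ blocks (suc a) m X)           ≡⟨ map-++ suc (block a X) (blocks (suc a) m X) ⟩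
    map suc (block a X) ++ map suc (blocks (suc a) m X) ≡⟨ cong₂ _++_ (trans (sym (map-∘ X)) (map-cong (λ c → sym (+-suc (c * k) a)) X))
                                                                      (map-suc-blocks m (suc a) X) ⟩
    block (suc a) X ++ blocks (suc (suc a)) m X         ∎
    where open ≡-Reasoning

  concatMap-block≡blocks : ∀ m a X → concatMap (λ j → block (a + j) X) (upTo m) ≡ blocks a m X
  concatMap-block≡blocks zero    a X = refl
  concatMap-block≡blocks (suc m) a X = cong₂ _++_ (cong (λ b → block b X) (+-identityʳ a)) (begin
    concatMap (λ j → block (a + j) X) (applyUpTo suc m)       ≡⟨ cong (concatMap (λ j → block (a + j) X)) (sym (map-upTo suc m)) ⟩
    concatMap (λ j → block (a + j) X) (map suc (upTo m))      ≡⟨ concatMap-map (λ j → block (a + j) X) suc (upTo m) ⟩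
    concatMap (λ j → block (a + suc j) X) (upTo m)            ≡⟨ concatMap-cong (λ j → cong (λ b → block b X) (+-suc a j)) (upTo m) ⟩
    concatMap (λ j → block (suc a + j) X) (upTo m)            ≡⟨ concatMap-block≡blocks m (suc a) X ⟩
    blocks (suc a) m X                                         ∎)
    where open ≡-Reasoning

  module _ (x₀ : ℕ) (X′ : List ℕ) where

    lastOf-blocks-≥ : ∀ m a → a + m ≤ lastOf (x₀ * k + a) (map (λ c → c * k + a) X′ ++ blocks (suc a) m (x₀ ∷ X′))
    lastOf-blocks-≥ zero    a = begin
      a + 0                                        ≡⟨ +-identityʳ a ⟩
      a                                            ≤⟨ m≤n+m a _ ⟩
      lastOf x₀ X′ * k + a                         ≡⟨ sym (lastOf-map (λ c → c * k + a) x₀ X′) ⟩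
      lastOf (x₀ * k + a) (map (λ c → c * k + a) X′)        ≡⟨ cong (lastOf (x₀ * k + a)) (++-identityʳ (map (λ c → c * k + a) X′)) ⟨
      lastOf (x₀ * k + a) (map (λ c → c * k + a) X′ ++ [])  ∎
      where open ≤-Reasoning
    lastOf-blocks-≥ (suc m) a = begin
      a + suc m    ≡⟨ +-suc a m ⟩
      suc a + m    ≤⟨ lastOf-blocks-≥ m (suc a) ⟩
      lastOf (x₀ * k + suc a) (map (λ c → c * k + suc a) X′ ++ blocks (suc (suc a)) m (x₀ ∷ X′))
        ≡⟨ sym (lastOf-++ (x₀ * k + a) (map (λ c → c * k + a) X′) _ _) ⟩
      lastOf (x₀ * k + a) (map (λ c → c * k + a) X′ ++ blocks (suc a) (suc m) (x₀ ∷ X′)) ∎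
      where open ≤-Reasoning

    descents-blocks : x₀ < lastOf x₀ X′ → ∀ m a → a + suc m ≤ k →
                      descents (blocks a (suc m) (x₀ ∷ X′)) ≡ suc m * descents (x₀ ∷ X′) + m
    descents-blocks x₀<last zero    a le = begin
      descents (block a (x₀ ∷ X′) ++ [])  ≡⟨ cong descents (++-identityʳ (block a (x₀ ∷ X′))) ⟩
      descents (block a (x₀ ∷ X′))        ≡⟨ descents-map (block-strictMono (subst (_≤ k) (+-comm a 1) le)) (x₀ ∷ X′) ⟩
      descents (x₀ ∷ X′)                  ≡⟨ sym (trans (+-identityʳ _) (*-identityˡ _)) ⟩
      1 * descents (x₀ ∷ X′) + 0          ∎
      where open ≡-Reasoning
    descents-blocks x₀<last (suc m) a le = begin
      descents (block a (x₀ ∷ X′) ++ blocks (suc a) (suc m) (x₀ ∷ X′))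
        ≡⟨ descents-++ (x₀ * k + a) (map (λ c → c * k + a) X′) (x₀ * k + suc a) _ ⟩
      descents (block a (x₀ ∷ X′)) + descentIndicator (lastOf (x₀ * k + a) (map (λ c → c * k + a) X′)) (x₀ * k + suc a)
        + descents (blocks (suc a) (suc m) (x₀ ∷ X′))
        ≡⟨ cong₂ _+_ (cong₂ _+_ (descents-map (block-strictMono a<k) (x₀ ∷ X′)) junction)
                     (descents-blocks x₀<last m (suc a) le′) ⟩
      descents (x₀ ∷ X′) + 1 + (suc m * descents (x₀ ∷ X′) + m)
        ≡⟨ reassoc (descents (x₀ ∷ X′)) m ⟩
      suc (suc m) * descents (x₀ ∷ X′) + suc m ∎
      where
      open ≡-Reasoning
      le′ : suc a + suc m ≤ k
      le′ = subst (_≤ k) (+-suc a (suc m)) le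
      a<k : a < k
      a<k = ≤-trans (s≤s (m≤m+n a (suc m))) le′
      1+a<k : suc a < k
      1+a<k = ≤-trans (s≤s (s≤s (m≤m+n a m))) (subst (λ x → suc x ≤ k) (+-suc a m) le′)
      junction : descentIndicator (lastOf (x₀ * k + a) (map (λ c → c * k + a) X′)) (x₀ * k + suc a) ≡ 1
      junction = begin
        descentIndicator (lastOf (x₀ * k + a) (map (λ c → c * k + a) X′)) (x₀ * k + suc a)
          ≡⟨ cong (λ l → descentIndicator l (x₀ * k + suc a)) (lastOf-map (λ c → c * k + a) x₀ X′) ⟩
        descentIndicator (lastOf x₀ X′ * k + a) (x₀ * k + suc a)
          ≡⟨ cong (λ b → if b then 1 else 0) (dec-true (_ <? _) (m<n⇒m*o+p<n*o+q x₀<last 1+a<k)) ⟩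
        1 ∎
      reassoc : ∀ D m → D + 1 + (suc m * D + m) ≡ suc (suc m) * D + suc m
      reassoc = solve-∀

module Reversal (k′ : ℕ) where

  k : ℕ
  k = suc (suc k′)

  open Digits k
  open Decomposition k
  open Blocks k

  -- Inversions between two blocks of blocks 0 k X are counted by inversionsBetween X X or
  -- inversionsBetween (map suc X) X, so the values of both are carried through the induction.
  record ReversalProfile (n : ℕ) (X : List ℕ) : Set where
    field
      rest             : List ℕ
      starts-with-0    : X ≡ 0 ∷ rest
      ends-positive    : 1 ≤ n → 1 ≤ lastOf 0 rest
      between-self     : 2 * inversionsBetween X X + k ^ n ≡ k ^ n * k ^ n
      between-suc      : inversionsBetween (map suc X) X ≡ inversionsBetween X X + k ^ n
      inversions-exact : 4 * inversions X + k ^ n * (1 + (k ∸ 1) * n) ≡ k ^ n * k ^ n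
      descents-bound   : k ^ (n ∸ 1) ≤ descents X + 1

  2*triangular-k : 2 * triangular k ≡ k * (k ∸ 1)
  2*triangular-k = +-cancelʳ-≡ k _ _ (trans (2*triangular+n≡n*n k) (square k′))
    where
    square : ∀ k′ → suc (suc k′) * suc (suc k′) ≡ suc (suc k′) * suc k′ + suc (suc k′)
    square = solve-∀

  profile-blocks : ∀ n X → ReversalProfile n X → ReversalProfile (suc n) (blocks 0 k X)
  profile-blocks n X record { rest = rest ; starts-with-0 = refl ; ends-positive = ends-positive
                            ; between-self = between-self ; between-suc = between-suc
                            ; inversions-exact = inversions-exact ; descents-bound = descents-bound } = record
    { rest             = map (λ c → c * k + 0) rest ++ blocks 1 (suc k′) X
    ; starts-with-0    = refl
    ; ends-positive    = λ _ → subst (1 ≤_) (sym (lastOf-++ 0 (map (λ c → c * k + 0) rest) _ _))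
                                         (≤-trans (s≤s z≤n) (lastOf-blocks-≥ 0 rest k′ 1))
    ; between-self     = between-self⁺
    ; between-suc      = between-suc⁺
    ; inversions-exact = inversions-exact⁺
    ; descents-bound   = descents-bound⁺ n ends-positive descents-bound
    }
    where
    K = k ^ n
    s = k ∸ 1
    t = triangular k
    C = inversionsBetween X X
    L = inversionsBetween (map suc X) X
    I = inversions X
    Y = blocks 0 k X

    between-suc-blocks : inversionsBetween (map suc Y) Y ≡ k * L + t * (C + L)
    between-suc-blocks = trans (cong (λ Z → inversionsBetween Z Y) (map-suc-blocks k 0 X)) (inversionsBetween-blocks-shifted X)

    between-self⁺ : 2 * inversionsBetween Y Y + k * K ≡ (k * K) * (k * K)
    between-self⁺ = begin
      2 * inversionsBetween Y Y + k * K     ≡⟨ cong (λ c → 2 * c + k * K) (inversionsBetween-blocks-self X) ⟩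
      2 * (k * C + t * (C + L)) + k * K     ≡⟨ cong (λ l → 2 * (k * C + t * (C + l)) + k * K) between-suc ⟩
      2 * (k * C + t * (C + (C + K))) + k * K ≡⟨ regroup t C K k ⟩
      (2 * t + k) * (2 * C + K)             ≡⟨ cong₂ _*_ (2*triangular+n≡n*n k) between-self ⟩
      (k * k) * (K * K)                     ≡⟨ interchange k K ⟩
      (k * K) * (k * K)                     ∎
      where
      open ≡-Reasoning
      regroup : ∀ t C K k → 2 * (k * C + t * (C + (C + K))) + k * K ≡ (2 * t + k) * (2 * C + K)
      regroup = solve-∀
      interchange : ∀ k K → (k * k) * (K * K) ≡ (k * K) * (k * K)
      interchange = solve-∀

    between-suc⁺ : inversionsBetween (map suc Y) Y ≡ inversionsBetween Y Y + k * K
    between-suc⁺ = begin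
      inversionsBetween (map suc Y) Y  ≡⟨ between-suc-blocks ⟩
      k * L + t * (C + L)              ≡⟨ cong (λ l → k * l + t * (C + L)) between-suc ⟩
      k * (C + K) + t * (C + L)        ≡⟨ regroup k C K (t * (C + L)) ⟩
      (k * C + t * (C + L)) + k * K    ≡⟨ cong (_+ k * K) (sym (inversionsBetween-blocks-self X)) ⟩
      inversionsBetween Y Y + k * K    ∎
      where
      open ≡-Reasoning
      regroup : ∀ k C K T → k * (C + K) + T ≡ (k * C + T) + k * K
      regroup = solve-∀

    inversions-exact⁺ : 4 * inversions Y + k * K * (1 + s * suc n) ≡ (k * K) * (k * K)
    inversions-exact⁺ = begin
      4 * inversions Y + k * K * (1 + s * suc n)
        ≡⟨ cong (λ i → 4 * i + k * K * (1 + s * suc n)) (inversions-blocks X k 0 ≤-refl) ⟩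
      4 * (k * I + t * C) + k * K * (1 + s * suc n)
        ≡⟨ regroup I t C K k s n ⟩
      k * A + (2 * t) * (2 * C) + k * K * s
        ≡⟨ cong (λ u → k * A + u * (2 * C) + k * K * s) 2*triangular-k ⟩
      k * A + k * s * (2 * C) + k * K * s
        ≡⟨ factor A C K k s ⟩
      k * A + k * s * (2 * C + K)
        ≡⟨ cong₂ (λ u v → k * u + k * s * v) inversions-exact between-self ⟩
      k * (K * K) + k * s * (K * K)
        ≡⟨ square K k′ ⟩
      (k * K) * (k * K) ∎
      where
      open ≡-Reasoning
      A = 4 * I + K * (1 + s * n)
      regroup : ∀ I t C K k s n → 4 * (k * I + t * C) + k * K * (1 + s * suc n)
                                  ≡ k * (4 * I + K * (1 + s * n)) + (2 * t) * (2 * C) + k * K * s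
      regroup = solve-∀
      factor : ∀ A C K k s → k * A + k * s * (2 * C) + k * K * s ≡ k * A + k * s * (2 * C + K)
      factor = solve-∀
      square : ∀ K k′ → suc (suc k′) * (K * K) + suc (suc k′) * suc k′ * (K * K) ≡ (suc (suc k′) * K) * (suc (suc k′) * K)
      square = solve-∀

    descents-bound⁺ : ∀ n → (1 ≤ n → 1 ≤ lastOf 0 rest) → k ^ (n ∸ 1) ≤ descents X + 1 → k ^ n ≤ descents Y + 1
    descents-bound⁺ zero    _             _       = m≤n+m 1 (descents Y)
    descents-bound⁺ (suc n) ends-positive bound = begin
      k * k ^ n                ≤⟨ *-monoʳ-≤ k bound ⟩
      k * (descents X + 1)     ≡⟨ regroup k′ (descents X) ⟩
      k * descents X + s + 1   ≡⟨ cong (_+ 1) (sym (descents-blocks 0 rest (ends-positive (s≤s z≤n)) s 0 ≤-refl)) ⟩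
      descents Y + 1           ∎
      where
      open ≤-Reasoning
      regroup : ∀ k′ D → suc (suc k′) * (D + 1) ≡ suc (suc k′) * D + suc k′ + 1
      regroup = solve-∀

  config-reversal : ∀ n (w : Permutation′ (suc n)) → DecreasingFrom (suc n) w 1 →
                    config k (suc n) w ≡ blocks 0 k (config k n (remove zero w))
  config-reversal n w dec = begin
    config k (suc n) w                                              ≡⟨ config-suc n w ⟩
    spread (insertDigit (n ∸ toℕ (w ⟨$⟩ʳ zero))) (config k n (remove zero w))
      ≡⟨ cong (λ b → spread (insertDigit b) (config k n (remove zero w))) (trans (cong (n ∸_) (decreasing-head w dec)) (n∸n≡0 n)) ⟩
    spread (insertDigit 0) (config k n (remove zero w))             ≡⟨ concatMap-block≡blocks k 0 (config k n (remove zero w)) ⟩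
    blocks 0 k (config k n (remove zero w))                         ∎
    where open ≡-Reasoning

  reversal-profile : ∀ n (w : Permutation′ n) → DecreasingFrom n w 1 → ReversalProfile n (config k n w)
  reversal-profile zero    w _   = record
    { rest = [] ; starts-with-0 = refl ; ends-positive = λ () ; between-self = refl ; between-suc = refl
    ; inversions-exact = cong (λ m → 1 * (1 + m)) (*-zeroʳ (suc k′)) ; descents-bound = ≤-refl }
  reversal-profile (suc n) w dec =
    subst (ReversalProfile (suc n)) (sym (config-reversal n w dec))
      (profile-blocks n _ (reversal-profile n (remove zero w)
        (DecreasingFrom-remove {w = w} {i₀ = 1} (DecreasingFrom-mono {w = w} {i₀ = 1} (s≤s z≤n) dec))))

-- Lower bounds

module Bounds (k′ : ℕ) where
  open Reversal k′
  open Digits k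
  open Decomposition k

  config-suc-≥ : ∀ n (w : Permutation′ (suc n)) →
    k * descents (config k n (remove zero w)) ≤ descents (config k (suc n) w) ×
    k * inversions (config k n (remove zero w)) ≤ inversions (config k (suc n) w)
  config-suc-≥ n w =
    subst₂ (λ m Z → m * descents X ≤ descents Z) (length-upTo k) (sym (config-suc n w)) (descents-concatMap-≥ ins X (upTo k) monotone) ,
    subst₂ (λ m Z → m * inversions X ≤ inversions Z) (length-upTo k) (sym (config-suc n w)) (inversions-concatMap-≥ ins X (upTo k) monotone)
    where
    X = config k n (remove zero w)
    ins = insertDigit (n ∸ toℕ (w ⟨$⟩ʳ zero))
    monotone : All (λ j → ins j Preserves _<_ ⟶ _<_) (upTo k)
    monotone = applyUpTo⁺₁ id k (λ j<k → insertDigit-strictMono (n ∸ toℕ (w ⟨$⟩ʳ zero)) j<k)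

  descents-lower-bound : ∀ n (w : Permutation′ n) i₀ → 1 ≤ i₀ → i₀ ≤ suc n → DecreasingFrom n w i₀ →
                         k ^ (n ∸ 1) ≤ descents (config k n w) + k ^ (i₀ ∸ 1)
  descents-lower-bound n       w 1             _ _            dec = ReversalProfile.descents-bound (reversal-profile n w dec)
  descents-lower-bound (suc n) w (suc (suc i)) _ (s≤s i₀≤1+n) dec = begin
    k ^ n                                      ≤⟨ k^n≤k*k^[n∸1] n ⟩
    k * k ^ (n ∸ 1)                            ≤⟨ *-monoʳ-≤ k (descents-lower-bound n w′ (suc i) (s≤s z≤n) i₀≤1+n dec′) ⟩
    k * (descents X + k ^ i)                   ≡⟨ *-distribˡ-+ k (descents X) (k ^ i) ⟩
    k * descents X + k * k ^ i                 ≤⟨ +-monoˡ-≤ (k * k ^ i) (proj₁ (config-suc-≥ n w)) ⟩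
    descents (config k (suc n) w) + k * k ^ i  ∎
    where
    open ≤-Reasoning
    w′ = remove zero w
    dec′ : DecreasingFrom n w′ (suc i)
    dec′ = DecreasingFrom-remove {w = w} dec
    X = config k n w′
    k^n≤k*k^[n∸1] : ∀ n → k ^ n ≤ k * k ^ (n ∸ 1)
    k^n≤k*k^[n∸1] zero    = s≤s z≤n
    k^n≤k*k^[n∸1] (suc n) = ≤-refl

  inversions-lower-bound : ∀ n (w : Permutation′ n) i₀ → 1 ≤ i₀ → i₀ ≤ suc n → DecreasingFrom n w i₀ →
                           k ^ n * ((k ^ (suc n ∸ i₀) ∸ 1) ∸ (k ∸ 1) * (suc n ∸ i₀)) ≤ 4 * inversions (config k n w)
  inversions-lower-bound n       w 1             _ _            dec = ≤-reflexive (begin-equality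
    K * ((K ∸ 1) ∸ (k ∸ 1) * n)           ≡⟨ cong (K *_) (∸-+-assoc K 1 ((k ∸ 1) * n)) ⟩
    K * (K ∸ (1 + (k ∸ 1) * n))           ≡⟨ *-distribˡ-∸ K K (1 + (k ∸ 1) * n) ⟩
    K * K ∸ K * (1 + (k ∸ 1) * n)         ≡⟨ cong (_∸ K * (1 + (k ∸ 1) * n)) (ReversalProfile.inversions-exact (reversal-profile n w dec)) ⟨
    4 * I + K * (1 + (k ∸ 1) * n) ∸ K * (1 + (k ∸ 1) * n) ≡⟨ m+n∸n≡m (4 * I) (K * (1 + (k ∸ 1) * n)) ⟩
    4 * I                           ∎)
    where
    open ≤-Reasoning
    K = k ^ n
    I = inversions (config k n w)
  inversions-lower-bound (suc n) w (suc (suc i)) _ (s≤s i₀≤1+n) dec = begin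
    k * k ^ n * Y                     ≡⟨ *-assoc k (k ^ n) Y ⟩
    k * (k ^ n * Y)                   ≤⟨ *-monoʳ-≤ k (inversions-lower-bound n w′ (suc i) (s≤s z≤n) i₀≤1+n dec′) ⟩
    k * (4 * inversions X)            ≡⟨ x∙yz≈y∙xz k 4 (inversions X) ⟩
    4 * (k * inversions X)            ≤⟨ *-monoʳ-≤ 4 (proj₂ (config-suc-≥ n w)) ⟩
    4 * inversions (config k (suc n) w) ∎
    where
    open ≤-Reasoning
    w′ = remove zero w
    dec′ : DecreasingFrom n w′ (suc i)
    dec′ = DecreasingFrom-remove {w = w} dec
    X = config k n w′
    Y = (k ^ (suc n ∸ suc i) ∸ 1) ∸ (k ∸ 1) * (suc n ∸ suc i)

  geometric-sum : ∀ a d → sum (map (λ j → (k ∸ 1) * k ^ (j ∸ 1)) (map (suc a +_) (upTo d))) + k ^ a ≡ k ^ (a + d)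
  geometric-sum a zero    = cong (k ^_) (sym (+-identityʳ a))
  geometric-sum a (suc d) = begin
    sum (map term (map (suc a +_) (upTo (suc d)))) + k ^ a
      ≡⟨ cong (λ js → sum (map term (map (suc a +_) js)) + k ^ a) (sym (upTo-∷ʳ d)) ⟩
    sum (map term (map (suc a +_) (upTo d ++ [ d ]))) + k ^ a
      ≡⟨ cong (λ xs → sum xs + k ^ a) (trans (cong (map term) (map-++ (suc a +_) (upTo d) [ d ])) (map-++ term _ [ suc a + d ])) ⟩
    sum (S ++ [ (k ∸ 1) * k ^ (a + d) ]) + k ^ a
      ≡⟨ cong (_+ k ^ a) (sum-++ S [ (k ∸ 1) * k ^ (a + d) ]) ⟩
    sum S + ((k ∸ 1) * k ^ (a + d) + 0) + k ^ a
      ≡⟨ regroup (k ∸ 1) (sum S) (k ^ a) (k ^ (a + d)) ⟩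
    (sum S + k ^ a) + (k ∸ 1) * k ^ (a + d)
      ≡⟨ cong (_+ (k ∸ 1) * k ^ (a + d)) (geometric-sum a d) ⟩
    k ^ (a + d) + (k ∸ 1) * k ^ (a + d)
      ≡⟨⟩
    k * k ^ (a + d)
      ≡⟨ cong (k ^_) (sym (+-suc a d)) ⟩
    k ^ (a + suc d) ∎
    where
    open ≡-Reasoning
    term = λ j → (k ∸ 1) * k ^ (j ∸ 1)
    S = map term (map (suc a +_) (upTo d))
    regroup : ∀ s Σ P Q → Σ + (s * Q + 0) + P ≡ (Σ + P) + s * Q
    regroup = solve-∀

  descents-sum-bound : ∀ n (w : Permutation′ n) a → suc a ≤ suc n → DecreasingFrom n w (suc a) →
                      sum (map (λ j → (k ∸ 1) * k ^ (j ∸ 1)) (range (suc a) n)) ≤ descents (config k n w)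
  descents-sum-bound zero    w zero    _         _ = z≤n
  descents-sum-bound zero    w (suc a) (s≤s ()) _
  descents-sum-bound (suc n) w a (s≤s a≤1+n) dec with m≤n⇒m<n∨m≡n a≤1+n
  ... | inj₂ refl = subst (λ m → sum (map term (map (suc (suc n) +_) (upTo m))) ≤ D) (sym (m≤n⇒m∸n≡0 (n≤1+n n))) z≤n
    where
    term = λ j → (k ∸ 1) * k ^ (j ∸ 1)
    D = descents (config k (suc n) w)
  ... | inj₁ (s≤s a≤n) = +-cancelʳ-≤ (k ^ a) _ D (subst (_≤ D + k ^ a) (sym sum+k^a≡k^n)
                                                  (descents-lower-bound (suc n) w (suc a) (s≤s z≤n) (s≤s a≤1+n) dec))
    where
    D = descents (config k (suc n) w)
    sum+k^a≡k^n : sum (map (λ j → (k ∸ 1) * k ^ (j ∸ 1)) (range (suc a) (suc n))) + k ^ a ≡ k ^ n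
    sum+k^a≡k^n = trans (geometric-sum a (n ∸ a)) (cong (k ^_) (m+[n∸m]≡n a≤n))

proposition6p4 : (k n : ℕ) → 2 ≤ k → (w : Permutation′ n) → (i₀ : ℕ) → 1 ≤ i₀ → i₀ ≤ suc n →
    ((i j : Fin n) → toℕ j ≡ suc (toℕ i) → i₀ ≤ suc (toℕ i) → toℕ (w ⟨$⟩ʳ j) < toℕ (w ⟨$⟩ʳ i)) →
    (sum (map (λ j → (k ∸ 1) * k ^ (j ∸ 1)) (range i₀ n)) ≤ descents (config k n w))
    × (k ^ n * (k ∸ 1) * ((k ^ (suc n ∸ i₀) ∸ 1) ∸ (k ∸ 1) * (suc n ∸ i₀)) ≤ 4 * (k ∸ 1) * inversions (config k n w))
proposition6p4 (suc (suc k′)) n (s≤s (s≤s z≤n)) w (suc a) 1≤i₀ i₀≤1+n dec =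
  descents-sum-bound n w a i₀≤1+n dec ,
  m*o≤n*p⇒m*q*o≤n*q*p (k ^ n) 4 (k ∸ 1) (inversions-lower-bound n w (suc a) 1≤i₀ i₀≤1+n dec)
  where
  open Reversal k′ using (k)
  open Bounds k′
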